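{- Let $m\ge2$ be an even integer and let $V\subseteq[m]$ be a set consisting of odd integers. Then $H_n(D^{(m,V)})=1$ for every $n\ge1$.
   Context: For an integer $m\ge 2$ and $V\subseteq[m]=\{1,\dots,m\}$, let $(m,V)=\{k\in\mathbb{Z}^+ : k\equiv j \pmod m \text{ for some } j\in V\}$. A Dyck path of size $n$ is a lattice path from $(0,0)$ to $(2n,0)$ with steps $(1,1)$ and $(1,-1)$ never going below the $x$-axis; a peak is an up-step immediately followed by a down-step, and its height is the $y$-coordinate of the point between them. Let $d_n^{(m,V)}$ be the number of Dyck paths of size $n$ none of whose peaks has height in $(m,V)$, and $D^{(m,V)}(x)=\sum_{n\ge0}d_n^{(m,V)}x^n$. For a power series $F=\sum f_nx^n$ and $n\ge1$, $H_n(F)=\det(f_{i+j})_{0\le i,j\le n-1}$. -}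

module Defs where

open import Data.Bool using (Bool; true; false; not; _∧_; _∨_; if_then_else_)
open import Data.Nat using (ℕ; zero; suc; _+_; _*_; _∸_; NonZero; _≡ᵇ_)
open import Data.Nat.DivMod using (_%_)
open import Data.Fin using (Fin; toℕ; punchIn)
import Data.Fin as F
open import Data.Fin.Subset using (Subset)
open import Data.List using (List; []; _∷_; length; filter; map; _++_)
open import Data.Vec using (lookup)
open import Data.Integer using (ℤ; +_; -_) renaming (_+_ to _+ℤ_; _*_ to _*ℤ_)
open import Relation.Binary.PropositionalEquality using (_≡_)
open import Relation.Nullary.Decidable using (Dec)
open import Data.Bool.Properties using (T?)
open import Data.Bool using (T)

-- Subsets V ⊆ [m] = {1,…,m} are encoded as V : Subset m, where
-- the element i : Fin m stands for the integer (toℕ i + 1).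

anyFin : (m : ℕ) → (Fin m → Bool) → Bool
anyFin zero    f = false
anyFin (suc m) f = f F.zero ∨ anyFin m (λ i → f (F.suc i))

inMV : (m : ℕ) .{{_ : NonZero m}} → Subset m → ℕ → Bool
inMV m V zero = false
inMV m V k@(suc _) =
  anyFin m (λ i → lookup V i ∧ ((k % m) ≡ᵇ ((toℕ i + 1) % m)))

-- Lattice paths are lists of steps: true = up-step (1,1), false = down-step (1,-1).

dyckFrom : ℕ → List Bool → Bool
dyckFrom zero    []            = true
dyckFrom (suc _) []            = false
dyckFrom h       (true ∷ xs)   = dyckFrom (suc h) xs
dyckFrom zero    (false ∷ xs)  = false
dyckFrom (suc h) (false ∷ xs)  = dyckFrom h xs

isDyck : List Bool → Bool
isDyck = dyckFrom 0

noBadPeakFrom : (ℕ → Bool) → ℕ → List Bool → Bool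
noBadPeakFrom bad h []                    = true
noBadPeakFrom bad h (true ∷ false ∷ xs)   = not (bad (suc h)) ∧ noBadPeakFrom bad (suc h) (false ∷ xs)
noBadPeakFrom bad h (true ∷ [])           = true
noBadPeakFrom bad h (true ∷ true ∷ xs)    = noBadPeakFrom bad (suc h) (true ∷ xs)
noBadPeakFrom bad h (false ∷ xs)          = noBadPeakFrom bad (h ∸ 1) xs

allPaths : ℕ → List (List Bool)
allPaths zero    = [] ∷ []
allPaths (suc n) = map (true ∷_) (allPaths n) ++ map (false ∷_) (allPaths n)

d : (m : ℕ) .{{_ : NonZero m}} → Subset m → ℕ → ℕ
d m V n = length (filter (λ p → T? (isDyck p ∧ noBadPeakFrom (inMV m V) 0 p)) (allPaths (2 * n)))

sumFin : (n : ℕ) → (Fin n → ℤ) → ℤ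
sumFin zero    f = + 0
sumFin (suc n) f = f F.zero +ℤ sumFin n (λ i → f (F.suc i))

sign : ℕ → ℤ
sign zero          = + 1
sign (suc zero)    = - (+ 1)
sign (suc (suc k)) = sign k

det : (n : ℕ) → (Fin n → Fin n → ℤ) → ℤ
det zero    M = + 1
det (suc n) M =
  sumFin (suc n) (λ j → sign (toℕ j) *ℤ (M F.zero j *ℤ det n (λ r c → M (F.suc r) (punchIn j c))))

hankel : (ℕ → ℤ) → ℕ → ℤ
hankel f n = det n (λ i j → f (toℕ i + toℕ j))

-- Cut a Dyck path into pairs of steps. Since no even height is forbidden, the number Q(n,k) of
-- peak-avoiding paths of length 2n from height 2k down to 0 satisfies
-- Q(n+1,k) = Q(n,k+1) + b_k Q(n,k) + Q(n,k-1), so Q(n,·) is row 0 of Jⁿ for a tridiagonal J with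
-- unit off-diagonal entries. As J is symmetric, d_{i+j} = Q(i+j,0) = Σ_k Q(i,k) Q(j,k): the Hankel
-- matrix is P Pᵀ with P = (Q(i,k)) unit lower triangular, so its determinant is 1.

module Submission where

open import Defs
open import Data.Nat using (ℕ; zero; suc; _≤_; _<_; NonZero; _+_; _%_; _≡ᵇ_; z≤n; z<s; s<s)
  renaming (_<?_ to _<?ℕ_)
import Data.Nat as ℕ
import Data.Nat.Properties as ℕₚ
open import Data.Nat.Divisibility using (_∣_; m∣m*n; %-presˡ-∣; ∣n∣m%n⇒∣m)
import Data.Nat.Tactic.RingSolver as ℕSolver
open import Data.Integer using (ℤ; +_; -_; _*_; +[1+_]; -[1+_]) renaming (_+_ to _+ℤ_)
import Data.Integer.Properties as ℤₚ
open import Data.Integer.Tactic.RingSolver using (solve-∀)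
open import Data.Fin using (Fin; toℕ; punchIn; punchOut; fromℕ<)
  renaming (zero to fzero; suc to fsuc; _<_ to _<ᶠ_)
import Data.Fin.Properties as Finₚ
open import Data.Fin.Subset using (Subset; _∈_)
open import Data.Bool using (Bool; true; false; _∧_; not; if_then_else_; T)
open import Data.Bool.Properties using (T?; ∧-zeroʳ)
open import Data.List using (List; []; _∷_; length; filter; map; _++_)
import Data.List.Properties as Listₚ
import Data.List.Relation.Unary.All as All
open import Data.Unit using (tt)
open import Data.Vec using (lookup)
open import Data.Vec.Properties using (lookup⇒[]=)
open import Data.Vec.Functional using (updateAt)
import Data.Vec.Functional.Properties as Vecₚ
open import Function using (_∘_; const)
open import Relation.Binary.PropositionalEquality
  using (_≡_; _≢_; refl; sym; trans; cong; cong₂; subst; module ≡-Reasoning)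
open import Relation.Nullary using (¬_; yes; no)
open import Relation.Nullary.Negation using (contradiction)
open import Algebra.Properties.AbelianGroup ℤₚ.+-0-abelianGroup using (∙-cancelˡ)
open import Algebra.Properties.Semiring.Sum ℤₚ.+-*-semiring
  using (sum; sum-syntax; sum-cong-≗; ∑-distrib-+; ∑-comm; sum-remove; sum-init-last;
         *-distribˡ-sum; sum-replicate-zero)

open ≡-Reasoning

private
  variable
    n : ℕ

sumFin≡sum : ∀ n (f : Fin n → ℤ) → sumFin n f ≡ sum f
sumFin≡sum zero    f = refl
sumFin≡sum (suc n) f = cong (f fzero +ℤ_) (sumFin≡sum n (f ∘ fsuc))

sum-zero : (f : Fin n → ℤ) → (∀ i → f i ≡ + 0) → sum f ≡ + 0
sum-zero {n} f f≗0 = trans (sum-cong-≗ f≗0) (sum-replicate-zero n)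

sum-neg : (f : Fin n → ℤ) → - sum f ≡ ∑[ i < n ] (- f i)
sum-neg f = trans (sym (ℤₚ.-1*i≡-i _)) (trans (*-distribˡ-sum (- + 1) f) (sum-cong-≗ (ℤₚ.-1*i≡-i ∘ f)))

sum-linear : (f g : Fin n → ℤ) (a : ℤ) → ∑[ j < n ] (f j +ℤ a * g j) ≡ sum f +ℤ a * sum g
sum-linear f g a = begin
  ∑[ j < _ ] (f j +ℤ a * g j)       ≡⟨ ∑-distrib-+ f (λ j → a * g j) ⟩
  sum f +ℤ ∑[ j < _ ] (a * g j)     ≡⟨ cong (sum f +ℤ_) (*-distribˡ-sum a g) ⟨
  sum f +ℤ a * sum g                ∎

sum-+₃ : (f g h : Fin n → ℤ) → ∑[ k < n ] (f k +ℤ g k +ℤ h k) ≡ sum f +ℤ sum g +ℤ sum h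
sum-+₃ f g h = trans (∑-distrib-+ (λ k → f k +ℤ g k) h) (cong (_+ℤ sum h) (∑-distrib-+ f g))

-- Both sides are the sum of F over all pairs of distinct indices.
sum-offDiagonal-swap : (F : Fin (suc n) → Fin (suc n) → ℤ) →
                       ∑[ j < suc n ] ∑[ k < n ] F j (punchIn j k) ≡ ∑[ j < suc n ] ∑[ k < n ] F (punchIn j k) j
sum-offDiagonal-swap {n} F = ∙-cancelˡ (∑[ j < suc n ] F j j) _ _ (begin
  ∑[ j < suc n ] F j j +ℤ ∑[ j < suc n ] ∑[ k < n ] F j (punchIn j k)
    ≡⟨ ∑-distrib-+ (λ j → F j j) (λ j → ∑[ k < n ] F j (punchIn j k)) ⟨
  ∑[ j < suc n ] (F j j +ℤ ∑[ k < n ] F j (punchIn j k))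
    ≡⟨ sum-cong-≗ (λ j → sum-remove {i = j} (F j)) ⟨
  ∑[ j < suc n ] ∑[ b < suc n ] F j b
    ≡⟨ ∑-comm F ⟩
  ∑[ b < suc n ] ∑[ j < suc n ] F j b
    ≡⟨ sum-cong-≗ (λ b → sum-remove {i = b} (λ j → F j b)) ⟩
  ∑[ b < suc n ] (F b b +ℤ ∑[ k < n ] F (punchIn b k) b)
    ≡⟨ ∑-distrib-+ (λ b → F b b) (λ b → ∑[ k < n ] F (punchIn b k) b) ⟩
  ∑[ j < suc n ] F j j +ℤ ∑[ j < suc n ] ∑[ k < n ] F (punchIn j k) j ∎)

-- Determinants

Matrix : ℕ → Set
Matrix n = Fin n → Fin n → ℤ

minor : Matrix (suc n) → Fin (suc n) → Matrix n
minor M j r c = M (fsuc r) (punchIn j c)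

laplaceTerm : (M : Matrix (suc n)) → Fin (suc n) → ℤ
laplaceTerm {n} M j = sign (toℕ j) * (M fzero j * det n (minor M j))

det-expand : (M : Matrix (suc n)) → det (suc n) M ≡ ∑[ j < suc n ] laplaceTerm M j
det-expand {n} M = sumFin≡sum (suc n) (laplaceTerm M)

laplaceTerm-zeroMinor : (M : Matrix (suc n)) (j : Fin (suc n)) →
                        det n (minor M j) ≡ + 0 → laplaceTerm M j ≡ + 0
laplaceTerm-zeroMinor M j minor≡0 = begin
  sign (toℕ j) * (M fzero j * det _ (minor M j)) ≡⟨ cong (λ d → sign (toℕ j) * (M fzero j * d)) minor≡0 ⟩
  sign (toℕ j) * (M fzero j * + 0)               ≡⟨ cong (sign (toℕ j) *_) (ℤₚ.*-zeroʳ (M fzero j)) ⟩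
  sign (toℕ j) * + 0                             ≡⟨ ℤₚ.*-zeroʳ (sign (toℕ j)) ⟩
  + 0                                            ∎

det-cong : {M N : Matrix n} → (∀ i j → M i j ≡ N i j) → det n M ≡ det n N
det-cong {zero}  M≗N = refl
det-cong {suc n} {M} {N} M≗N = begin
  det (suc n) M              ≡⟨ det-expand M ⟩
  ∑[ j < suc n ] laplaceTerm M j
    ≡⟨ sum-cong-≗ (λ j → cong₂ (λ x y → sign (toℕ j) * (x * y))
         (M≗N fzero j) (det-cong (λ r c → M≗N (fsuc r) (punchIn j c)))) ⟩
  ∑[ j < suc n ] laplaceTerm N j ≡⟨ det-expand N ⟨
  det (suc n) N              ∎

mutual
  det-zeroColumn : (M : Matrix (suc n)) → (∀ i → M i fzero ≡ + 0) → det (suc n) M ≡ + 0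
  det-zeroColumn {n} M column≡0 = begin
    det (suc n) M                                                 ≡⟨ det-expand M ⟩
    laplaceTerm M fzero +ℤ ∑[ j < n ] laplaceTerm M (fsuc j)
      ≡⟨ cong₂ _+ℤ_ (cong (λ x → + 1 * (x * det n (minor M fzero))) (column≡0 fzero))
                    (sum-zero _ (laplaceTerm-zeroColumn M (column≡0 ∘ fsuc))) ⟩
    + 0                                                           ∎

  laplaceTerm-zeroColumn : (M : Matrix (suc n)) → (∀ i → M (fsuc i) fzero ≡ + 0) →
                           ∀ j → laplaceTerm M (fsuc j) ≡ + 0
  laplaceTerm-zeroColumn {suc n} M column≡0 j =
    laplaceTerm-zeroMinor M (fsuc j) (det-zeroColumn (minor M (fsuc j)) column≡0)

_[_]≔_ : Matrix n → Fin n → (Fin n → ℤ) → Matrix n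
M [ r ]≔ v = updateAt M r (const v)

minor-[]≔ : (M : Matrix (suc n)) (r : Fin n) (v : Fin (suc n) → ℤ) (j : Fin (suc n)) →
            ∀ i c → minor (M [ fsuc r ]≔ v) j i c ≡ (minor M j [ r ]≔ (v ∘ punchIn j)) i c
minor-[]≔ M r v j i c with i Finₚ.≟ r
... | yes refl = trans (cong (λ row → row (punchIn j c)) (Vecₚ.updateAt-updates r (M ∘ fsuc)))
                       (sym (cong (λ row → row c) (Vecₚ.updateAt-updates r (minor M j))))
... | no i≢r   = trans (cong (λ row → row (punchIn j c)) (Vecₚ.updateAt-minimal i r (M ∘ fsuc) i≢r))
                       (sym (cong (λ row → row c) (Vecₚ.updateAt-minimal i r (minor M j) i≢r)))

mutual
  det-linear : (M : Matrix n) (r : Fin n) (x y : Fin n → ℤ) (a : ℤ) →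
               det n (M [ r ]≔ (λ c → x c +ℤ a * y c)) ≡ det n (M [ r ]≔ x) +ℤ a * det n (M [ r ]≔ y)
  det-linear {suc n} M r x y a = begin
    det (suc n) (M [ r ]≔ z)                                ≡⟨ det-expand (M [ r ]≔ z) ⟩
    ∑[ j < suc n ] laplaceTerm (M [ r ]≔ z) j               ≡⟨ sum-cong-≗ (laplaceTerm-linear M r x y a) ⟩
    ∑[ j < suc n ] (laplaceTerm (M [ r ]≔ x) j +ℤ a * laplaceTerm (M [ r ]≔ y) j)
      ≡⟨ sum-linear (laplaceTerm (M [ r ]≔ x)) (laplaceTerm (M [ r ]≔ y)) a ⟩
    sum (laplaceTerm (M [ r ]≔ x)) +ℤ a * sum (laplaceTerm (M [ r ]≔ y))
      ≡⟨ cong₂ (λ p q → p +ℤ a * q) (det-expand (M [ r ]≔ x)) (det-expand (M [ r ]≔ y)) ⟨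
    det (suc n) (M [ r ]≔ x) +ℤ a * det (suc n) (M [ r ]≔ y) ∎
    where
    z = λ c → x c +ℤ a * y c

  laplaceTerm-linear : (M : Matrix (suc n)) (r : Fin (suc n)) (x y : Fin (suc n) → ℤ) (a : ℤ) → ∀ j →
                       laplaceTerm (M [ r ]≔ (λ c → x c +ℤ a * y c)) j
                         ≡ laplaceTerm (M [ r ]≔ x) j +ℤ a * laplaceTerm (M [ r ]≔ y) j
  laplaceTerm-linear {n} M fzero x y a j = distribute (sign (toℕ j)) (x j) (y j) a (det n (minor M j))
    where
    distribute : ∀ s x y a d → s * ((x +ℤ a * y) * d) ≡ s * (x * d) +ℤ a * (s * (y * d))
    distribute = solve-∀
  laplaceTerm-linear {n} M (fsuc r) x y a j = begin
    s * (M fzero j * det n (minor (M [ fsuc r ]≔ (λ c → x c +ℤ a * y c)) j))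
      ≡⟨ cong (λ d → s * (M fzero j * d)) (det-cong (minor-[]≔ M r (λ c → x c +ℤ a * y c) j)) ⟩
    s * (M fzero j * det n (minor M j [ r ]≔ (λ c → x′ c +ℤ a * y′ c)))
      ≡⟨ cong (λ d → s * (M fzero j * d)) (det-linear (minor M j) r x′ y′ a) ⟩
    s * (M fzero j * (det n (minor M j [ r ]≔ x′) +ℤ a * det n (minor M j [ r ]≔ y′)))
      ≡⟨ distribute s (M fzero j) (det n (minor M j [ r ]≔ x′)) a (det n (minor M j [ r ]≔ y′)) ⟩
    s * (M fzero j * det n (minor M j [ r ]≔ x′)) +ℤ a * (s * (M fzero j * det n (minor M j [ r ]≔ y′)))
      ≡⟨ cong₂ (λ p q → s * (M fzero j * p) +ℤ a * (s * (M fzero j * q)))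
           (det-cong (minor-[]≔ M r x j)) (det-cong (minor-[]≔ M r y j)) ⟨
    laplaceTerm (M [ fsuc r ]≔ x) j +ℤ a * laplaceTerm (M [ fsuc r ]≔ y) j ∎
    where
    s  = sign (toℕ j)
    x′ = x ∘ punchIn j
    y′ = y ∘ punchIn j
    distribute : ∀ s m p a q → s * (m * (p +ℤ a * q)) ≡ s * (m * p) +ℤ a * (s * (m * q))
    distribute = solve-∀

sign-suc : ∀ x → sign (suc x) ≡ - sign x
sign-suc zero          = refl
sign-suc (suc zero)    = refl
sign-suc (suc (suc x)) = sign-suc x

-- If punchIn (punchIn j k) k' ≡ j, deleting column j and then k, or column punchIn j k and then k',
-- deletes the same two columns.
punchIn-punchIn-swap : ∀ (j : Fin (suc (suc n))) k k' → punchIn (punchIn j k) k' ≡ j →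
                       ∀ c → punchIn (punchIn j k) (punchIn k' c) ≡ punchIn j (punchIn k c)
punchIn-punchIn-swap         fzero    k        fzero     _ c        = refl
punchIn-punchIn-swap {suc n} fzero    k        (fsuc k') () c
punchIn-punchIn-swap         (fsuc j) fzero    .j        refl c     = refl
punchIn-punchIn-swap {suc n} (fsuc j) (fsuc k) fzero     () c
punchIn-punchIn-swap {suc n} (fsuc j) (fsuc k) (fsuc k') eq fzero   = refl
punchIn-punchIn-swap {suc n} (fsuc j) (fsuc k) (fsuc k') eq (fsuc c) =
  cong fsuc (punchIn-punchIn-swap j k k' (Finₚ.suc-injective eq) c)

sign-punchIn-swap : ∀ (j : Fin (suc (suc n))) k k' → punchIn (punchIn j k) k' ≡ j →
                    sign (toℕ (punchIn j k)) * sign (toℕ k') ≡ - (sign (toℕ j) * sign (toℕ k))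
sign-punchIn-swap fzero k fzero _ = begin
  sign (suc (toℕ k)) * + 1 ≡⟨ cong (_* + 1) (sign-suc (toℕ k)) ⟩
  - sign (toℕ k) * + 1     ≡⟨ flip (sign (toℕ k)) ⟩
  - (+ 1 * sign (toℕ k))   ∎
  where
  flip : ∀ a → - a * + 1 ≡ - (+ 1 * a)
  flip = solve-∀
sign-punchIn-swap {suc n} fzero k (fsuc k') ()
sign-punchIn-swap (fsuc j) fzero .j refl = begin
  + 1 * sign (toℕ j)              ≡⟨ flip (sign (toℕ j)) ⟩
  - (- sign (toℕ j) * + 1)        ≡⟨ cong (λ s → - (s * + 1)) (sign-suc (toℕ j)) ⟨
  - (sign (suc (toℕ j)) * + 1)    ∎
  where
  flip : ∀ a → + 1 * a ≡ - (- a * + 1)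
  flip = solve-∀
sign-punchIn-swap {suc n} (fsuc j) (fsuc k) fzero ()
sign-punchIn-swap {suc n} (fsuc j) (fsuc k) (fsuc k') eq
  rewrite sign-suc (toℕ (punchIn j k)) | sign-suc (toℕ k') | sign-suc (toℕ j) | sign-suc (toℕ k)
  = trans (neg*neg (sign (toℕ (punchIn j k))) (sign (toℕ k')))
      (trans (sign-punchIn-swap j k k' (Finₚ.suc-injective eq))
             (cong -_ (sym (neg*neg (sign (toℕ j)) (sign (toℕ k))))))
  where
  neg*neg : ∀ a b → - a * - b ≡ a * b
  neg*neg = solve-∀

complement₂ : (L : Fin n → Fin (suc (suc n)) → ℤ) → Fin (suc (suc n)) → Fin (suc n) → ℤ
complement₂ {n} L j k = det n (λ r c → L r (punchIn j (punchIn k c)))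

-- The cofactor of the 2 × 2 minor in rows 0, 1 and columns a, b, given the remaining rows L.
cofactor₂ : (L : Fin n → Fin (suc (suc n)) → ℤ) → Fin (suc (suc n)) → Fin (suc (suc n)) → ℤ
cofactor₂ L a b with a Finₚ.≟ b
... | yes _   = + 0
... | no a≢b  = sign (toℕ a) * sign (toℕ (punchOut a≢b)) * complement₂ L a (punchOut a≢b)

cofactor₂-punchIn : (L : Fin n → Fin (suc (suc n)) → ℤ) (j : Fin (suc (suc n))) (k : Fin (suc n)) →
                    cofactor₂ L j (punchIn j k) ≡ sign (toℕ j) * sign (toℕ k) * complement₂ L j k
cofactor₂-punchIn L j k with j Finₚ.≟ punchIn j k
... | yes j≡jₖ = contradiction (sym j≡jₖ) (Finₚ.punchInᵢ≢i j k)
... | no j≢jₖ  = cong (λ k' → sign (toℕ j) * sign (toℕ k') * complement₂ L j k')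
                      (trans (Finₚ.punchOut-cong j refl) (Finₚ.punchOut-punchIn j))

cofactor₂-antisym : (L : Fin n → Fin (suc (suc n)) → ℤ) (j : Fin (suc (suc n))) (k : Fin (suc n)) →
                    cofactor₂ L (punchIn j k) j ≡ - cofactor₂ L j (punchIn j k)
cofactor₂-antisym L j k with punchIn j k Finₚ.≟ j
... | yes jₖ≡j = contradiction jₖ≡j (Finₚ.punchInᵢ≢i j k)
... | no jₖ≢j  = begin
  sign (toℕ (punchIn j k)) * sign (toℕ k') * complement₂ L (punchIn j k) k'
    ≡⟨ cong₂ _*_ (sign-punchIn-swap j k k' back)
                 (det-cong (λ r c → cong (L r) (punchIn-punchIn-swap j k k' back c))) ⟩
  - (sign (toℕ j) * sign (toℕ k)) * complement₂ L j k
    ≡⟨ ℤₚ.neg-distribˡ-* (sign (toℕ j) * sign (toℕ k)) (complement₂ L j k) ⟨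
  - (sign (toℕ j) * sign (toℕ k) * complement₂ L j k) ≡⟨ cong -_ (cofactor₂-punchIn L j k) ⟨
  - cofactor₂ L j (punchIn j k)                       ∎
  where
  k'   = punchOut jₖ≢j
  back = Finₚ.punchIn-punchOut jₖ≢j

det-expand₂ : (M : Matrix (suc (suc n))) →
              det (suc (suc n)) M
                ≡ ∑[ j < suc (suc n) ] ∑[ k < suc n ]
                    (M fzero j * M (fsuc fzero) (punchIn j k) * cofactor₂ (M ∘ fsuc ∘ fsuc) j (punchIn j k))
det-expand₂ {n} M = trans (det-expand M) (sum-cong-≗ row)
  where
  L = M ∘ fsuc ∘ fsuc
  row : ∀ j → laplaceTerm M j ≡ ∑[ k < suc n ]
                 (M fzero j * M (fsuc fzero) (punchIn j k) * cofactor₂ L j (punchIn j k))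
  row j = begin
    sign (toℕ j) * (M fzero j * det (suc n) (minor M j))
      ≡⟨ cong (λ d → sign (toℕ j) * (M fzero j * d)) (det-expand (minor M j)) ⟩
    sign (toℕ j) * (M fzero j * sum (laplaceTerm (minor M j)))
      ≡⟨ trans (cong (sign (toℕ j) *_) (*-distribˡ-sum (M fzero j) (laplaceTerm (minor M j))))
               (*-distribˡ-sum (sign (toℕ j)) (λ k → M fzero j * laplaceTerm (minor M j) k)) ⟩
    ∑[ k < suc n ] (sign (toℕ j) * (M fzero j * laplaceTerm (minor M j) k))
      ≡⟨ sum-cong-≗ term ⟩
    ∑[ k < suc n ] (M fzero j * M (fsuc fzero) (punchIn j k) * cofactor₂ L j (punchIn j k)) ∎
    where
    regroup : ∀ s x t y d → s * (x * (t * (y * d))) ≡ x * y * (s * t * d)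
    regroup = solve-∀
    term : ∀ k → sign (toℕ j) * (M fzero j * laplaceTerm (minor M j) k)
                   ≡ M fzero j * M (fsuc fzero) (punchIn j k) * cofactor₂ L j (punchIn j k)
    term k = trans (regroup (sign (toℕ j)) (M fzero j) (sign (toℕ k)) (M (fsuc fzero) (punchIn j k)) (complement₂ L j k))
                   (cong (M fzero j * M (fsuc fzero) (punchIn j k) *_) (sym (cofactor₂-punchIn L j k)))

swapRows01 : Matrix (suc (suc n)) → Matrix (suc (suc n))
swapRows01 M fzero           = M (fsuc fzero)
swapRows01 M (fsuc fzero)    = M fzero
swapRows01 M (fsuc (fsuc i)) = M (fsuc (fsuc i))

-- In the expansion along rows 0 and 1, the swap exchanges the two columns of every 2 × 2 minor.
det-swapRows01 : (M : Matrix (suc (suc n))) → det (suc (suc n)) (swapRows01 M) ≡ - det (suc (suc n)) M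
det-swapRows01 {n} M = begin
  det (suc (suc n)) (swapRows01 M)
    ≡⟨ det-expand₂ (swapRows01 M) ⟩
  ∑[ j < suc (suc n) ] ∑[ k < suc n ] (M (fsuc fzero) j * M fzero (punchIn j k) * cofactor₂ L j (punchIn j k))
    ≡⟨ sum-cong-≗ (λ j → sum-cong-≗ (λ k → swapped j k)) ⟩
  ∑[ j < suc (suc n) ] ∑[ k < suc n ] (- F (punchIn j k) j)
    ≡⟨ sum-cong-≗ (λ j → sum-neg (λ k → F (punchIn j k) j)) ⟨
  ∑[ j < suc (suc n) ] (- ∑[ k < suc n ] F (punchIn j k) j)
    ≡⟨ sum-neg (λ j → ∑[ k < suc n ] F (punchIn j k) j) ⟨
  - ∑[ j < suc (suc n) ] ∑[ k < suc n ] F (punchIn j k) j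
    ≡⟨ cong -_ (sum-offDiagonal-swap F) ⟨
  - ∑[ j < suc (suc n) ] ∑[ k < suc n ] F j (punchIn j k)
    ≡⟨ cong -_ (det-expand₂ M) ⟨
  - det (suc (suc n)) M ∎
  where
  L = M ∘ fsuc ∘ fsuc
  F : Fin (suc (suc n)) → Fin (suc (suc n)) → ℤ
  F a b = M fzero a * M (fsuc fzero) b * cofactor₂ L a b
  swapped : ∀ j k → M (fsuc fzero) j * M fzero (punchIn j k) * cofactor₂ L j (punchIn j k) ≡ - F (punchIn j k) j
  swapped j k = begin
    M (fsuc fzero) j * M fzero (punchIn j k) * cofactor₂ L j (punchIn j k)
      ≡⟨ cong (M (fsuc fzero) j * M fzero (punchIn j k) *_) (ℤₚ.neg-involutive _) ⟨
    M (fsuc fzero) j * M fzero (punchIn j k) * - - cofactor₂ L j (punchIn j k)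
      ≡⟨ cong (λ x → M (fsuc fzero) j * M fzero (punchIn j k) * - x) (cofactor₂-antisym L j k) ⟨
    M (fsuc fzero) j * M fzero (punchIn j k) * - cofactor₂ L (punchIn j k) j
      ≡⟨ regroup (M (fsuc fzero) j) (M fzero (punchIn j k)) (cofactor₂ L (punchIn j k) j) ⟩
    - F (punchIn j k) j ∎
    where
    regroup : ∀ x y c → x * y * - c ≡ - (y * x * c)
    regroup = solve-∀

x≡-x⇒x≡0 : ∀ x → x ≡ - x → x ≡ + 0
x≡-x⇒x≡0 (+ zero) _  = refl
x≡-x⇒x≡0 +[1+ _ ] ()
x≡-x⇒x≡0 -[1+ _ ] ()

det-equalLowerRows : (∀ (N : Matrix n) {a b} → a ≢ b → (∀ c → N a c ≡ N b c) → det n N ≡ + 0) →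
                     (M : Matrix (suc n)) {a b : Fin n} → a ≢ b →
                     (∀ c → M (fsuc a) c ≡ M (fsuc b) c) → det (suc n) M ≡ + 0
det-equalLowerRows equalRows⇒0 M a≢b rows≡ = trans (det-expand M) (sum-zero _ λ j →
  laplaceTerm-zeroMinor M j (equalRows⇒0 (minor M j) a≢b (rows≡ ∘ punchIn j)))

mutual
  det-equalRows : (M : Matrix n) {a b : Fin n} → a ≢ b → (∀ c → M a c ≡ M b c) → det n M ≡ + 0
  det-equalRows M {fzero}  {fzero}  0≢0 _     = contradiction refl 0≢0
  det-equalRows M {fzero}  {fsuc b} _   rows≡ = det-equalRow0 M b rows≡
  det-equalRows M {fsuc a} {fzero}  _   rows≡ = det-equalRow0 M a (sym ∘ rows≡)
  det-equalRows M {fsuc a} {fsuc b} a≢b rows≡ = det-equalLowerRows det-equalRows M (a≢b ∘ cong fsuc) rows≡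

  det-equalRow0 : (M : Matrix (suc n)) (b : Fin n) → (∀ c → M fzero c ≡ M (fsuc b) c) → det (suc n) M ≡ + 0
  det-equalRow0 M fzero rows≡ =
    x≡-x⇒x≡0 _ (trans (det-cong swap≗M) (det-swapRows01 M))
    where
    swap≗M : ∀ i c → M i c ≡ swapRows01 M i c
    swap≗M fzero           c = rows≡ c
    swap≗M (fsuc fzero)    c = sym (rows≡ c)
    swap≗M (fsuc (fsuc i)) c = refl
  det-equalRow0 {suc n} M (fsuc b) rows≡ = begin
    det (suc (suc n)) M                   ≡⟨ ℤₚ.neg-involutive _ ⟨
    - - det (suc (suc n)) M               ≡⟨ cong -_ (det-swapRows01 M) ⟨
    - det (suc (suc n)) (swapRows01 M)
      ≡⟨ cong -_ (det-equalLowerRows det-equalRows (swapRows01 M) {fzero} {fsuc b} (λ ()) rows≡) ⟩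
    + 0                                   ∎

addMultipleOfRow0 : Fin n → ℤ → Matrix (suc n) → Matrix (suc n)
addMultipleOfRow0 r a M = M [ fsuc r ]≔ (λ c → M (fsuc r) c +ℤ a * M fzero c)

det-addMultipleOfRow0 : (r : Fin n) (a : ℤ) (M : Matrix (suc n)) →
                        det (suc n) (addMultipleOfRow0 r a M) ≡ det (suc n) M
det-addMultipleOfRow0 {n} r a M = begin
  det (suc n) (addMultipleOfRow0 r a M)
    ≡⟨ det-linear M (fsuc r) (M (fsuc r)) (M fzero) a ⟩
  det (suc n) (M [ fsuc r ]≔ M (fsuc r)) +ℤ a * det (suc n) (M [ fsuc r ]≔ M fzero)
    ≡⟨ cong₂ (λ p q → p +ℤ a * q)
         (det-cong (λ i c → cong (λ row → row c) (Vecₚ.updateAt-id-local (fsuc r) M refl i)))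
         (det-equalRow0 (M [ fsuc r ]≔ M fzero) r
           (λ c → sym (cong (λ row → row c) (Vecₚ.updateAt-updates (fsuc r) M)))) ⟩
  det (suc n) M +ℤ a * + 0
    ≡⟨ trans (cong (det (suc n) M +ℤ_) (ℤₚ.*-zeroʳ a)) (ℤₚ.+-identityʳ _) ⟩
  det (suc n) M ∎

addMultiplesOfRow0 : (Fin n → ℤ) → Matrix (suc n) → Matrix (suc n)
addMultiplesOfRow0 u M fzero    c = M fzero c
addMultiplesOfRow0 u M (fsuc r) c = M (fsuc r) c +ℤ u r * M fzero c

addMultiplesOfRow0-split : (u : Fin n → ℤ) (M : Matrix (suc n)) (r : Fin n) → ∀ i c →
  addMultiplesOfRow0 u M i c ≡ addMultipleOfRow0 r (u r) (addMultiplesOfRow0 (updateAt u r (const (+ 0))) M) i c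
addMultiplesOfRow0-split u M r fzero    c = refl
addMultiplesOfRow0-split u M r (fsuc i) c with i Finₚ.≟ r
... | yes refl = begin
  M (fsuc i) c +ℤ u i * M fzero c
    ≡⟨ add-zero (M (fsuc i) c) (u i * M fzero c) (M fzero c) ⟩
  M (fsuc i) c +ℤ + 0 * M fzero c +ℤ u i * M fzero c
    ≡⟨ cong (λ a → M (fsuc i) c +ℤ a * M fzero c +ℤ u i * M fzero c) (Vecₚ.updateAt-updates i u) ⟨
  M (fsuc i) c +ℤ u′ i * M fzero c +ℤ u i * M fzero c
    ≡⟨ cong (λ row → row c) (Vecₚ.updateAt-updates (fsuc i) N) ⟨
  addMultipleOfRow0 i (u i) N (fsuc i) c ∎
  where
  u′ = updateAt u i (const (+ 0))
  N  = addMultiplesOfRow0 u′ M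
  add-zero : ∀ x y z → x +ℤ y ≡ x +ℤ + 0 * z +ℤ y
  add-zero = solve-∀
... | no i≢r = begin
  M (fsuc i) c +ℤ u i * M fzero c
    ≡⟨ cong (λ a → M (fsuc i) c +ℤ a * M fzero c) (Vecₚ.updateAt-minimal i r u i≢r) ⟨
  addMultiplesOfRow0 u′ M (fsuc i) c
    ≡⟨ cong (λ row → row c)
         (Vecₚ.updateAt-minimal (fsuc i) (fsuc r) (addMultiplesOfRow0 u′ M) (i≢r ∘ Finₚ.suc-injective)) ⟨
  addMultipleOfRow0 r (u r) (addMultiplesOfRow0 u′ M) (fsuc i) c ∎
  where
  u′ = updateAt u r (const (+ 0))

det-addMultiplesOfRow0 : (u : Fin n → ℤ) (M : Matrix (suc n)) →
                         det (suc n) (addMultiplesOfRow0 u M) ≡ det (suc n) M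
det-addMultiplesOfRow0 {n} u M = vanishingFrom n u (λ r n≤r → contradiction (Finₚ.toℕ<n r) (ℕₚ.≤⇒≯ n≤r))
  where
  vanishingFrom : ∀ k u → (∀ r → k ≤ toℕ r → u r ≡ + 0) →
                  det (suc n) (addMultiplesOfRow0 u M) ≡ det (suc n) M
  vanishingFrom zero u u≡0 = det-cong {M = addMultiplesOfRow0 u M} {N = M} λ where
    fzero    c → refl
    (fsuc r) c → trans (cong (λ a → M (fsuc r) c +ℤ a * M fzero c) (u≡0 r z≤n)) (ℤₚ.+-identityʳ (M (fsuc r) c))
  vanishingFrom (suc k) u u≡0 with k <?ℕ n
  ... | no k≮n  = vanishingFrom k u (λ r k≤r → contradiction (ℕₚ.≤-<-trans k≤r (Finₚ.toℕ<n r)) k≮n)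
  ... | yes k<n = begin
    det (suc n) (addMultiplesOfRow0 u M)                           ≡⟨ det-cong (addMultiplesOfRow0-split u M r) ⟩
    det (suc n) (addMultipleOfRow0 r (u r) (addMultiplesOfRow0 u′ M))
      ≡⟨ det-addMultipleOfRow0 r (u r) (addMultiplesOfRow0 u′ M) ⟩
    det (suc n) (addMultiplesOfRow0 u′ M)                          ≡⟨ vanishingFrom k u′ u′≡0 ⟩
    det (suc n) M                                                  ∎
    where
    r  = fromℕ< k<n
    u′ = updateAt u r (const (+ 0))
    u′≡0 : ∀ i → k ≤ toℕ i → u′ i ≡ + 0
    u′≡0 i k≤i with i Finₚ.≟ r
    ... | yes refl = Vecₚ.updateAt-updates r u
    ... | no i≢r   = trans (Vecₚ.updateAt-minimal i r u i≢r) (u≡0 i (ℕₚ.≤∧≢⇒< k≤i k≢i))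
      where
      k≢i : k ≢ toℕ i
      k≢i k≡i = i≢r (Finₚ.toℕ-injective (trans (sym k≡i) (sym (Finₚ.toℕ-fromℕ< k<n))))

gram : {m : ℕ} → (Fin n → Fin m → ℤ) → Matrix n
gram {m = m} P i j = ∑[ k < m ] (P i k * P j k)

record UnitLowerTriangular (P : Matrix n) : Set where
  field
    diagonal : ∀ i → P i i ≡ + 1
    above    : ∀ {i j} → i <ᶠ j → P i j ≡ + 0

unitLowerTriangular-minor0 : {P : Matrix (suc n)} → UnitLowerTriangular P → UnitLowerTriangular (minor P fzero)
unitLowerTriangular-minor0 tri = record
  { diagonal = diagonal ∘ fsuc
  ; above    = λ i<j → above (s<s i<j)
  }
  where open UnitLowerTriangular tri

-- Clearing column 0 below the pivot leaves the Gram matrix of the remaining columns of P.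
det-gram : (P : Matrix n) → UnitLowerTriangular P → det n (gram P) ≡ + 1
det-gram {zero}  P _   = refl
det-gram {suc n} P tri = begin
  det (suc n) (gram P)                                      ≡⟨ det-addMultiplesOfRow0 u (gram P) ⟨
  det (suc n) R                                             ≡⟨ det-expand R ⟩
  laplaceTerm R fzero +ℤ ∑[ j < n ] laplaceTerm R (fsuc j)
    ≡⟨ cong₂ _+ℤ_ pivot (sum-zero _ (laplaceTerm-zeroColumn R reducedColumn0)) ⟩
  + 1                                                       ∎
  where
  open UnitLowerTriangular tri
  u : Fin n → ℤ
  u r = - P (fsuc r) fzero
  R = addMultiplesOfRow0 u (gram P)

  gram-row0 : ∀ c → gram P fzero c ≡ P c fzero
  gram-row0 c = begin
    P fzero fzero * P c fzero +ℤ ∑[ k < n ] (P fzero (fsuc k) * P c (fsuc k))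
      ≡⟨ cong₂ (λ p s → p * P c fzero +ℤ s) (diagonal fzero)
               (sum-zero _ (λ k → cong (_* P c (fsuc k)) (above z<s))) ⟩
    + 1 * P c fzero +ℤ + 0  ≡⟨ trans (ℤₚ.+-identityʳ _) (ℤₚ.*-identityˡ _) ⟩
    P c fzero               ∎

  reduced : ∀ r c → R (fsuc r) c ≡ ∑[ k < n ] (P (fsuc r) (fsuc k) * P c (fsuc k))
  reduced r c = begin
    gram P (fsuc r) c +ℤ u r * gram P fzero c
      ≡⟨ cong (λ g → gram P (fsuc r) c +ℤ u r * g) (gram-row0 c) ⟩
    P (fsuc r) fzero * P c fzero +ℤ rest +ℤ - P (fsuc r) fzero * P c fzero
      ≡⟨ cancel (P (fsuc r) fzero) (P c fzero) rest ⟩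
    rest ∎
    where
    rest = ∑[ k < n ] (P (fsuc r) (fsuc k) * P c (fsuc k))
    cancel : ∀ x y s → x * y +ℤ s +ℤ - x * y ≡ s
    cancel = solve-∀

  reducedColumn0 : ∀ r → R (fsuc r) fzero ≡ + 0
  reducedColumn0 r = trans (reduced r fzero)
    (sum-zero _ (λ k → trans (cong (P (fsuc r) (fsuc k) *_) (above z<s)) (ℤₚ.*-zeroʳ (P (fsuc r) (fsuc k)))))

  pivot : laplaceTerm R fzero ≡ + 1
  pivot = begin
    + 1 * (R fzero fzero * det n (minor R fzero))
      ≡⟨ cong₂ (λ p d → + 1 * (p * d)) (trans (gram-row0 fzero) (diagonal fzero))
               (det-cong (λ r c → reduced r (fsuc c))) ⟩
    + 1 * (+ 1 * det n (gram (minor P fzero)))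
      ≡⟨ cong (λ d → + 1 * (+ 1 * d)) (det-gram (minor P fzero) (unitLowerTriangular-minor0 tri)) ⟩
    + 1 ∎

-- Jacobi matrices and their moments

sum-last : (f : ℕ → ℤ) (N : ℕ) → ∑[ k < suc N ] f (toℕ k) ≡ ∑[ k < N ] f (toℕ k) +ℤ f N
sum-last f N = trans (sum-init-last {n = N} (f ∘ toℕ))
  (cong₂ _+ℤ_ (sum-cong-≗ {N} (cong f ∘ Finₚ.toℕ-inject₁)) (cong f (Finₚ.toℕ-fromℕ N)))

below : (ℕ → ℤ) → ℕ → ℤ
below f zero    = + 0
below f (suc k) = f k

sum-shift : (f g : ℕ → ℤ) (N : ℕ) →
            ∑[ k < suc N ] (f (suc (toℕ k)) * g (toℕ k))
              ≡ ∑[ k < suc N ] (f (toℕ k) * below g (toℕ k)) +ℤ f (suc N) * g N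
sum-shift f g N = begin
  ∑[ k < suc N ] (f (suc (toℕ k)) * g (toℕ k))
    ≡⟨ sum-last (λ k → f (suc k) * g k) N ⟩
  ∑[ k < N ] (f (suc (toℕ k)) * g (toℕ k)) +ℤ f (suc N) * g N
    ≡⟨ cong (_+ℤ f (suc N) * g N) (trans (cong (_+ℤ shifted) (ℤₚ.*-zeroʳ (f 0))) (ℤₚ.+-identityˡ shifted)) ⟨
  f 0 * + 0 +ℤ shifted +ℤ f (suc N) * g N ∎
  where
  shifted = ∑[ k < N ] (f (suc (toℕ k)) * g (toℕ k))

jacobiStep : (ℕ → ℤ) → (ℕ → ℤ) → ℕ → ℤ
jacobiStep b f k = f (suc k) +ℤ b k * f k +ℤ below f k

-- jacobiRow b n is row 0 of Jⁿ, for J the tridiagonal matrix with diagonal b and off-diagonal entries 1.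
jacobiRow : (ℕ → ℤ) → ℕ → ℕ → ℤ
jacobiRow b zero    zero    = + 1
jacobiRow b zero    (suc k) = + 0
jacobiRow b (suc n) k       = jacobiStep b (jacobiRow b n) k

0+c*0+x≡x : ∀ c x → + 0 +ℤ c * + 0 +ℤ x ≡ x
0+c*0+x≡x = solve-∀

jacobiRow-above : (b : ℕ → ℤ) {n k : ℕ} → n < k → jacobiRow b n k ≡ + 0
jacobiRow-above b {zero}  {suc k} _         = refl
jacobiRow-above b {suc n} {suc k} (s<s n<k) = begin
  jacobiRow b n (suc (suc k)) +ℤ b (suc k) * jacobiRow b n (suc k) +ℤ jacobiRow b n k
    ≡⟨ cong₂ (λ x y → x +ℤ b (suc k) * y +ℤ jacobiRow b n k)
             (jacobiRow-above b (ℕₚ.m<n⇒m<1+n (ℕₚ.m<n⇒m<1+n n<k)))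
             (jacobiRow-above b (ℕₚ.m<n⇒m<1+n n<k)) ⟩
  + 0 +ℤ b (suc k) * + 0 +ℤ jacobiRow b n k
    ≡⟨ trans (0+c*0+x≡x (b (suc k)) (jacobiRow b n k)) (jacobiRow-above b n<k) ⟩
  + 0 ∎

jacobiRow-diagonal : (b : ℕ → ℤ) (n : ℕ) → jacobiRow b n n ≡ + 1
jacobiRow-diagonal b zero    = refl
jacobiRow-diagonal b (suc n) = begin
  jacobiRow b n (suc (suc n)) +ℤ b (suc n) * jacobiRow b n (suc n) +ℤ jacobiRow b n n
    ≡⟨ cong₂ (λ x y → x +ℤ b (suc n) * y +ℤ jacobiRow b n n)
             (jacobiRow-above b (ℕₚ.m<n⇒m<1+n (ℕₚ.n<1+n n)))
             (jacobiRow-above b (ℕₚ.n<1+n n)) ⟩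
  + 0 +ℤ b (suc n) * + 0 +ℤ jacobiRow b n n
    ≡⟨ trans (0+c*0+x≡x (b (suc n)) (jacobiRow b n n)) (jacobiRow-diagonal b n) ⟩
  + 1 ∎

jacobiStep-selfAdjoint : (b f g : ℕ → ℤ) (N : ℕ) → f (suc N) ≡ + 0 → f N ≡ + 0 →
                         ∑[ k < suc N ] (jacobiStep b f (toℕ k) * g (toℕ k))
                           ≡ ∑[ k < suc N ] (f (toℕ k) * jacobiStep b g (toℕ k))
jacobiStep-selfAdjoint b f g N f[1+N]≡0 f[N]≡0 = begin
  Σ (λ k → jacobiStep b f k * g k)
    ≡⟨ trans (sum-cong-≗ {suc N} (unfoldˡ ∘ toℕ))
             (Σ-+₃ (λ k → f (suc k) * g k) diagonal (λ k → g k * below f k)) ⟩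
  Σ (λ k → f (suc k) * g k) +ℤ Σ diagonal +ℤ Σ (λ k → g k * below f k)
    ≡⟨ cong₂ (λ x z → x +ℤ Σ diagonal +ℤ z) lowerShift upperShift ⟩
  Σ (λ k → f k * below g k) +ℤ Σ diagonal +ℤ Σ (λ k → g (suc k) * f k)
    ≡⟨ swapOuter (Σ (λ k → f k * below g k)) (Σ diagonal) (Σ (λ k → g (suc k) * f k)) ⟩
  Σ (λ k → g (suc k) * f k) +ℤ Σ diagonal +ℤ Σ (λ k → f k * below g k)
    ≡⟨ trans (sym (Σ-+₃ (λ k → g (suc k) * f k) diagonal (λ k → f k * below g k)))
             (sum-cong-≗ {suc N} (unfoldʳ ∘ toℕ)) ⟩
  Σ (λ k → f k * jacobiStep b g k) ∎
  where
  Σ : (ℕ → ℤ) → ℤ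
  Σ h = ∑[ k < suc N ] h (toℕ k)
  Σ-+₃ : ∀ h₁ h₂ h₃ → Σ (λ k → h₁ k +ℤ h₂ k +ℤ h₃ k) ≡ Σ h₁ +ℤ Σ h₂ +ℤ Σ h₃
  Σ-+₃ h₁ h₂ h₃ = sum-+₃ {suc N} (h₁ ∘ toℕ) (h₂ ∘ toℕ) (h₃ ∘ toℕ)
  diagonal : ℕ → ℤ
  diagonal k = b k * f k * g k
  expandˡ : ∀ f⁺ c f₀ f⁻ g₀ → (f⁺ +ℤ c * f₀ +ℤ f⁻) * g₀ ≡ f⁺ * g₀ +ℤ c * f₀ * g₀ +ℤ g₀ * f⁻
  expandˡ = solve-∀
  expandʳ : ∀ f₀ g⁺ c g₀ g⁻ → g⁺ * f₀ +ℤ c * f₀ * g₀ +ℤ f₀ * g⁻ ≡ f₀ * (g⁺ +ℤ c * g₀ +ℤ g⁻)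
  expandʳ = solve-∀
  unfoldˡ : ∀ k → jacobiStep b f k * g k ≡ f (suc k) * g k +ℤ diagonal k +ℤ g k * below f k
  unfoldˡ k = expandˡ (f (suc k)) (b k) (f k) (below f k) (g k)
  unfoldʳ : ∀ k → g (suc k) * f k +ℤ diagonal k +ℤ f k * below g k ≡ f k * jacobiStep b g k
  unfoldʳ k = expandʳ (f k) (g (suc k)) (b k) (g k) (below g k)
  swapOuter : ∀ x y z → x +ℤ y +ℤ z ≡ z +ℤ y +ℤ x
  swapOuter = solve-∀
  lowerShift : Σ (λ k → f (suc k) * g k) ≡ Σ (λ k → f k * below g k)
  lowerShift = begin
    Σ (λ k → f (suc k) * g k)                        ≡⟨ sum-shift f g N ⟩
    Σ (λ k → f k * below g k) +ℤ f (suc N) * g N     ≡⟨ cong (λ x → Σ (λ k → f k * below g k) +ℤ x * g N) f[1+N]≡0 ⟩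
    Σ (λ k → f k * below g k) +ℤ + 0 * g N           ≡⟨ ℤₚ.+-identityʳ _ ⟩
    Σ (λ k → f k * below g k)                        ∎
  upperShift : Σ (λ k → g k * below f k) ≡ Σ (λ k → g (suc k) * f k)
  upperShift = begin
    Σ (λ k → g k * below f k)                        ≡⟨ ℤₚ.+-identityʳ _ ⟨
    Σ (λ k → g k * below f k) +ℤ + 0
      ≡⟨ cong (Σ (λ k → g k * below f k) +ℤ_) (ℤₚ.*-zeroʳ (g (suc N))) ⟨
    Σ (λ k → g k * below f k) +ℤ g (suc N) * + 0
      ≡⟨ cong (λ x → Σ (λ k → g k * below f k) +ℤ g (suc N) * x) f[N]≡0 ⟨
    Σ (λ k → g k * below f k) +ℤ g (suc N) * f N     ≡⟨ sum-shift g f N ⟨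
    Σ (λ k → g (suc k) * f k)                        ∎

jacobiRow-moments : (b : ℕ → ℤ) (i j N : ℕ) → i < N →
                    ∑[ k < N ] (jacobiRow b i (toℕ k) * jacobiRow b j (toℕ k)) ≡ jacobiRow b (i + j) 0
jacobiRow-moments b zero j (suc N) _ = begin
  + 1 * jacobiRow b j 0 +ℤ ∑[ k < N ] (+ 0 * jacobiRow b j (suc (toℕ k)))
    ≡⟨ cong (+ 1 * jacobiRow b j 0 +ℤ_) (sum-zero {N} (λ k → + 0 * jacobiRow b j (suc (toℕ k))) (λ _ → refl)) ⟩
  + 1 * jacobiRow b j 0 +ℤ + 0
    ≡⟨ trans (ℤₚ.+-identityʳ _) (ℤₚ.*-identityˡ _) ⟩
  jacobiRow b j 0 ∎
jacobiRow-moments b (suc i) j (suc N) (s<s i<N) = begin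
  ∑[ k < suc N ] (jacobiStep b (jacobiRow b i) (toℕ k) * jacobiRow b j (toℕ k))
    ≡⟨ jacobiStep-selfAdjoint b (jacobiRow b i) (jacobiRow b j) N
         (jacobiRow-above b (ℕₚ.m<n⇒m<1+n i<N)) (jacobiRow-above b i<N) ⟩
  ∑[ k < suc N ] (jacobiRow b i (toℕ k) * jacobiRow b (suc j) (toℕ k))
    ≡⟨ jacobiRow-moments b i (suc j) (suc N) (ℕₚ.m<n⇒m<1+n i<N) ⟩
  jacobiRow b (i + suc j) 0
    ≡⟨ cong (λ m → jacobiRow b m 0) (ℕₚ.+-suc i j) ⟩
  jacobiRow b (suc i + j) 0 ∎

hankel-jacobiMoments : (b : ℕ → ℤ) (n : ℕ) → hankel (λ k → jacobiRow b k 0) n ≡ + 1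
hankel-jacobiMoments b n = begin
  det n (λ i j → jacobiRow b (toℕ i + toℕ j) 0)
    ≡⟨ det-cong (λ i j → sym (jacobiRow-moments b (toℕ i) (toℕ j) n (Finₚ.toℕ<n i))) ⟩
  det n (gram P)
    ≡⟨ det-gram P (record { diagonal = jacobiRow-diagonal b ∘ toℕ ; above = jacobiRow-above b }) ⟩
  + 1 ∎
  where
  P : Matrix n
  P i k = jacobiRow b (toℕ i) (toℕ k)

-- Counting paths with forbidden peak heights

#paths : (List Bool → Bool) → ℕ → ℕ
#paths P L = length (filter (λ p → T? (P p)) (allPaths L))

length-filter-map : (P : List Bool → Bool) (g : List Bool → List Bool) (ps : List (List Bool)) →
                    length (filter (λ p → T? (P p)) (map g ps)) ≡ length (filter (λ p → T? (P (g p))) ps)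
length-filter-map P g []       = refl
length-filter-map P g (p ∷ ps) with P (g p)
... | true  = cong suc (length-filter-map P g ps)
... | false = length-filter-map P g ps

#paths-suc : (P : List Bool → Bool) (L : ℕ) →
             #paths P (suc L) ≡ #paths (P ∘ (true ∷_)) L + #paths (P ∘ (false ∷_)) L
#paths-suc P L = begin
  length (filter P? (map (true ∷_) (allPaths L) ++ map (false ∷_) (allPaths L)))
    ≡⟨ cong length (Listₚ.filter-++ P? (map (true ∷_) (allPaths L)) (map (false ∷_) (allPaths L))) ⟩
  length (filter P? (map (true ∷_) (allPaths L)) ++ filter P? (map (false ∷_) (allPaths L)))
    ≡⟨ Listₚ.length-++ (filter P? (map (true ∷_) (allPaths L))) ⟩
  length (filter P? (map (true ∷_) (allPaths L))) + length (filter P? (map (false ∷_) (allPaths L)))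
    ≡⟨ cong₂ _+_ (length-filter-map P (true ∷_) (allPaths L)) (length-filter-map P (false ∷_) (allPaths L)) ⟩
  #paths (P ∘ (true ∷_)) L + #paths (P ∘ (false ∷_)) L ∎
  where
  P? = λ p → T? (P p)

#paths-none : (P : List Bool → Bool) (L : ℕ) → (∀ p → P p ≡ false) → #paths P L ≡ 0
#paths-none P L P≡false =
  cong length (Listₚ.filter-none (λ p → T? (P p)) (All.universal (λ p t → subst T (P≡false p) t) (allPaths L)))

double-suc : ∀ k → 2 ℕ.* suc k ≡ 2 + 2 ℕ.* k
double-suc = ℕₚ.*-suc 2

pos-+*+ : ∀ a c x y → + (a + c ℕ.* x + y) ≡ + a +ℤ + c * + x +ℤ + y
pos-+*+ a c x y = trans (ℤₚ.pos-+ (a + c ℕ.* x) y)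
  (cong (_+ℤ + y) (trans (ℤₚ.pos-+ a (c ℕ.* x)) (cong (+ a +ℤ_) (ℤₚ.pos-* c x))))

module PeakAvoidingWalks (bad : ℕ → Bool) where

  walks : ℕ → ℕ → ℕ
  walks L h = #paths (λ p → dyckFrom h p ∧ noBadPeakFrom bad h p) L

  walksAfterUp : ℕ → ℕ → ℕ
  walksAfterUp L h = #paths (λ p → dyckFrom (suc h) p ∧ noBadPeakFrom bad h (true ∷ p)) L

  peakAllowed : ℕ → ℕ
  peakAllowed h = if bad h then 0 else 1

  walks-suc-zero : ∀ L → walks (suc L) 0 ≡ walksAfterUp L 0
  walks-suc-zero L = begin
    walks (suc L) 0                                  ≡⟨ #paths-suc _ L ⟩
    walksAfterUp L 0 + #paths (λ _ → false) L        ≡⟨ cong (_+_ (walksAfterUp L 0)) (#paths-none _ L (λ _ → refl)) ⟩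
    walksAfterUp L 0 + 0                             ≡⟨ ℕₚ.+-identityʳ _ ⟩
    walksAfterUp L 0                                 ∎

  walks-suc-suc : ∀ L h → walks (suc L) (suc h) ≡ walksAfterUp L (suc h) + walks L h
  walks-suc-suc L h = #paths-suc _ L

  walksAfterUp-suc : ∀ L h → walksAfterUp (suc L) h ≡ walksAfterUp L (suc h) + peakAllowed (suc h) ℕ.* walks L h
  walksAfterUp-suc L h = trans (#paths-suc _ L) (cong (_+_ (walksAfterUp L (suc h))) peakThenDown)
    where
    peakThenDown : #paths (λ p → dyckFrom h p ∧ (not (bad (suc h)) ∧ noBadPeakFrom bad h p)) L
                     ≡ peakAllowed (suc h) ℕ.* walks L h
    peakThenDown with bad (suc h)
    ... | true  = #paths-none _ L (λ p → ∧-zeroʳ (dyckFrom h p))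
    ... | false = sym (ℕₚ.+-identityʳ _)

  walksAfterUp-allowed : ∀ L h → bad (suc h) ≡ false → walksAfterUp L h ≡ walks L (suc h)
  walksAfterUp-allowed zero    h _       = refl
  walksAfterUp-allowed (suc L) h allowed = begin
    walksAfterUp (suc L) h                                          ≡⟨ walksAfterUp-suc L h ⟩
    walksAfterUp L (suc h) + peakAllowed (suc h) ℕ.* walks L h
      ≡⟨ cong (λ a → walksAfterUp L (suc h) + (if a then 0 else 1) ℕ.* walks L h) allowed ⟩
    walksAfterUp L (suc h) + 1 ℕ.* walks L h
      ≡⟨ cong (_+_ (walksAfterUp L (suc h))) (ℕₚ.*-identityˡ _) ⟩
    walksAfterUp L (suc h) + walks L h                              ≡⟨ walks-suc-suc L h ⟨
    walks (suc L) (suc h)                                           ∎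

  walks-twoSteps-zero : ∀ L → bad 2 ≡ false → walks (2 + L) 0 ≡ walks L 2 + peakAllowed 1 ℕ.* walks L 0
  walks-twoSteps-zero L allowed = begin
    walks (2 + L) 0                                   ≡⟨ walks-suc-zero (suc L) ⟩
    walksAfterUp (suc L) 0                            ≡⟨ walksAfterUp-suc L 0 ⟩
    walksAfterUp L 1 + peakAllowed 1 ℕ.* walks L 0
      ≡⟨ cong (_+ peakAllowed 1 ℕ.* walks L 0) (walksAfterUp-allowed L 1 allowed) ⟩
    walks L 2 + peakAllowed 1 ℕ.* walks L 0           ∎

  walks-twoSteps-suc : ∀ L h → bad (2 + h) ≡ false → bad (4 + h) ≡ false →
    walks (2 + L) (2 + h) ≡ walks L (4 + h) + (peakAllowed (3 + h) + 1) ℕ.* walks L (2 + h) + walks L h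
  walks-twoSteps-suc L h allowed₂ allowed₄ = begin
    walks (2 + L) (2 + h)
      ≡⟨ walks-suc-suc (suc L) (suc h) ⟩
    walksAfterUp (suc L) (2 + h) + walks (suc L) (suc h)
      ≡⟨ cong₂ _+_ (walksAfterUp-suc L (2 + h)) (walks-suc-suc L h) ⟩
    (walksAfterUp L (3 + h) + peakAllowed (3 + h) ℕ.* walks L (2 + h)) + (walksAfterUp L (suc h) + walks L h)
      ≡⟨ cong₂ (λ x y → (x + peakAllowed (3 + h) ℕ.* walks L (2 + h)) + (y + walks L h))
               (walksAfterUp-allowed L (3 + h) allowed₄) (walksAfterUp-allowed L (suc h) allowed₂) ⟩
    (walks L (4 + h) + peakAllowed (3 + h) ℕ.* walks L (2 + h)) + (walks L (2 + h) + walks L h)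
      ≡⟨ collect (walks L (4 + h)) (peakAllowed (3 + h)) (walks L (2 + h)) (walks L h) ⟩
    walks L (4 + h) + (peakAllowed (3 + h) + 1) ℕ.* walks L (2 + h) + walks L h ∎
    where
    collect : ∀ a g b c → (a + g ℕ.* b) + (b + c) ≡ a + (g + 1) ℕ.* b + c
    collect = ℕSolver.solve-∀

  -- Two steps from height 2k+2 back to itself go up-down, with a peak at 2k+3, or down-up,
  -- through a valley at 2k+1; from height 0 only up-down is possible.
  peakWeight : ℕ → ℤ
  peakWeight zero    = + peakAllowed 1
  peakWeight (suc k) = + (peakAllowed (3 + 2 ℕ.* k) + 1)

  walks-jacobiRow : (∀ k → bad (2 ℕ.* suc k) ≡ false) →
                    ∀ n k → + walks (2 ℕ.* n) (2 ℕ.* k) ≡ jacobiRow peakWeight n k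
  walks-jacobiRow evenAllowed zero    zero    = refl
  walks-jacobiRow evenAllowed zero    (suc k) = refl
  walks-jacobiRow evenAllowed (suc n) k       = begin
    + walks (2 ℕ.* suc n) (2 ℕ.* k)  ≡⟨ cong (λ L → + walks L (2 ℕ.* k)) (double-suc n) ⟩
    + walks (2 + 2 ℕ.* n) (2 ℕ.* k)  ≡⟨ twoSteps k ⟩
    jacobiRow peakWeight (suc n) k   ∎
    where
    L = 2 ℕ.* n
    row : ∀ k h → 2 ℕ.* k ≡ h → + walks L h ≡ jacobiRow peakWeight n k
    row k h refl = walks-jacobiRow evenAllowed n k
    twoSteps : ∀ k → + walks (2 + L) (2 ℕ.* k) ≡ jacobiRow peakWeight (suc n) k
    twoSteps zero = begin
      + walks (2 + L) 0                                         ≡⟨ cong +_ (walks-twoSteps-zero L (evenAllowed 0)) ⟩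
      + (walks L 2 + peakAllowed 1 ℕ.* walks L 0)               ≡⟨ cong +_ (ℕₚ.+-identityʳ _) ⟨
      + (walks L 2 + peakAllowed 1 ℕ.* walks L 0 + 0)           ≡⟨ pos-+*+ (walks L 2) (peakAllowed 1) (walks L 0) 0 ⟩
      + walks L 2 +ℤ peakWeight 0 * + walks L 0 +ℤ + 0
        ≡⟨ cong₂ (λ x y → x +ℤ peakWeight 0 * y +ℤ + 0) (row 1 2 refl) (row 0 0 refl) ⟩
      jacobiRow peakWeight (suc n) 0                            ∎
    twoSteps (suc k) = begin
      + walks (2 + L) (2 ℕ.* suc k)
        ≡⟨ cong (λ h → + walks (2 + L) h) (double-suc k) ⟩
      + walks (2 + L) (2 + h)
        ≡⟨ cong +_ (walks-twoSteps-suc L h (subst (λ x → bad x ≡ false) (double-suc k) (evenAllowed k))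
                                              (subst (λ x → bad x ≡ false) double-suc² (evenAllowed (suc k)))) ⟩
      + (walks L (4 + h) + (peakAllowed (3 + h) + 1) ℕ.* walks L (2 + h) + walks L h)
        ≡⟨ pos-+*+ (walks L (4 + h)) (peakAllowed (3 + h) + 1) (walks L (2 + h)) (walks L h) ⟩
      + walks L (4 + h) +ℤ peakWeight (suc k) * + walks L (2 + h) +ℤ + walks L h
        ≡⟨ cong₂ (λ x y → x +ℤ peakWeight (suc k) * y +ℤ + walks L h)
                 (row (suc (suc k)) (4 + h) double-suc²) (row (suc k) (2 + h) (double-suc k)) ⟩
      jacobiRow peakWeight n (suc (suc k)) +ℤ peakWeight (suc k) * jacobiRow peakWeight n (suc k) +ℤ + walks L h
        ≡⟨ cong (jacobiRow peakWeight n (suc (suc k)) +ℤ peakWeight (suc k) * jacobiRow peakWeight n (suc k) +ℤ_)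
                (row k h refl) ⟩
      jacobiRow peakWeight (suc n) (suc k) ∎
      where
      h = 2 ℕ.* k
      double-suc² : 2 ℕ.* suc (suc k) ≡ 4 + h
      double-suc² = trans (double-suc (suc k)) (cong (_+_ 2) (double-suc k))

anyFin-false : ∀ m (f : Fin m → Bool) → (∀ i → f i ≡ false) → anyFin m f ≡ false
anyFin-false zero    f _       = refl
anyFin-false (suc m) f f≡false rewrite f≡false fzero = anyFin-false m (f ∘ fsuc) (f≡false ∘ fsuc)

-- An even height is congruent mod the even m only to even residues, and V contains none.
inMV-even : ∀ m .{{_ : NonZero m}} (V : Subset m) → 2 ∣ m → (∀ i → i ∈ V → ¬ (2 ∣ toℕ i + 1)) →
            ∀ h → 2 ∣ h → inMV m V h ≡ false
inMV-even m V 2∣m Vodd zero    _   = refl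
inMV-even m V 2∣m Vodd (suc x) 2∣h = anyFin-false m _ noWitness
  where
  noWitness : ∀ i → (lookup V i ∧ (suc x % m ≡ᵇ (toℕ i + 1) % m)) ≡ false
  noWitness i with lookup V i in i∈V
  ... | false = refl
  ... | true with suc x % m ≡ᵇ (toℕ i + 1) % m in sameResidue
  ... | false = refl
  ... | true  = contradiction (∣n∣m%n⇒∣m 2∣m (subst (2 ∣_) residues≡ (%-presˡ-∣ 2∣h 2∣m)))
                              (Vodd i (lookup⇒[]= i V i∈V))
    where
    residues≡ = ℕₚ.≡ᵇ⇒≡ (suc x % m) ((toℕ i + 1) % m) (subst T (sym sameResidue) tt)

corollary3p5 : (m : ℕ) .{{_ : NonZero m}} → 2 ≤ m → 2 ∣ m →
               (V : Subset m) → (∀ i → i ∈ V → ¬ (2 ∣ toℕ i + 1)) →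
               (n : ℕ) → 1 ≤ n → hankel (λ k → + d m V k) n ≡ + 1
corollary3p5 m _ 2∣m V Vodd n _ = begin
  hankel (λ k → + d m V k) n                ≡⟨ det-cong {n} (λ i j → walks-jacobiRow evenAllowed (toℕ i + toℕ j) 0) ⟩
  hankel (λ k → jacobiRow peakWeight k 0) n ≡⟨ hankel-jacobiMoments peakWeight n ⟩
  + 1                                       ∎
  where
  open PeakAvoidingWalks (inMV m V)
  evenAllowed : ∀ k → inMV m V (2 ℕ.* suc k) ≡ false
  evenAllowed k = inMV-even m V 2∣m Vodd (2 ℕ.* suc k) (m∣m*n (suc k))
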